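{- Let $P$ be a positive logic, let $L=\mathrm{Int}+P$, and let $\Gamma/\Delta$ be a positive multiple-conclusion rule. Then $\Gamma/\Delta$ is admissible for $P$ if and only if $\Gamma/\Delta$ is admissible for $L$.
   Context: Formulas are built from a countable set of propositional variables using the binary connectives $\land,\lor,\to$ and the constant $\bot$. $\mathrm{Frm}$ is the set of all formulas and $\mathrm{Frm}^+$ is the set of positive formulas, i.e. those not containing $\bot$. A substitution is a map from variables to $\mathrm{Frm}$, extended to formulas in the usual way; a positive substitution maps variables to $\mathrm{Frm}^+$. $\mathrm{Int}$ is the set of theorems of intuitionistic propositional logic and $\mathrm{Int}^+=\mathrm{Int}\cap\mathrm{Frm}^+$. A superintuitionistic (si-)logic is a set of formulas containing $\mathrm{Int}$ and closed under modus ponens and substitutions. A positive logic is a set of positive formulas containing $\mathrm{Int}^+$ and closed under modus ponens and positive substitutions. For a set $\Gamma$ of formulas, $\mathrm{Int}+\Gamma$ is the least si-logic containing $\mathrm{Int}\cup\Gamma$. A multiple-conclusion rule $\Gamma/\Delta$ is an ordered pair of finite sets of formulas (premises $\Gamma$, conclusions $\Delta$); it is positive if all its formulas are positive. A substitution $\sigma$ unifies a formula $A$ in an si-logic $L$ if $\sigma(A)\in L$; a positive substitution $\sigma$ unifies a positive formula $A$ in a positive logic $P$ if $\sigma(A)\in P$. A rule $\Gamma/\Delta$ is admissible for an si-logic $L$ if every substitution unifying in $L$ all formulas of $\Gamma$ unifies in $L$ at least one formula of $\Delta$. A positive rule is admissible for a positive logic $P$ if every positive substitution unifying in $P$ all formulas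 of $\Gamma$ unifies in $P$ at least one formula of $\Delta$. If $\Gamma=\varnothing$, every substitution counts as unifying $\Gamma$; if $\Delta=\varnothing$, no substitution unifies a formula of $\Delta$. -}

module Defs where

open import Data.Nat using (ℕ)
open import Data.List using (List)
open import Data.List.Relation.Unary.All using (All)
open import Data.List.Relation.Unary.Any using (Any)
open import Data.Product using (_×_)

infixr 6 _∧_
infixr 5 _∨_
infixr 4 _⇒_

data Frm : Set where
  var : ℕ → Frm
  ⊥'  : Frm
  _∧_ : Frm → Frm → Frm
  _∨_ : Frm → Frm → Frm
  _⇒_ : Frm → Frm → Frm

data Positive : Frm → Set where
  var : ∀ n → Positive (var n)
  _∧_ : ∀ {A B} → Positive A → Positive B → Positive (A ∧ B)
  _∨_ : ∀ {A B} → Positive A → Positive B → Positive (A ∨ B)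
  _⇒_ : ∀ {A B} → Positive A → Positive B → Positive (A ⇒ B)

FSet : Set₁
FSet = Frm → Set

_⊆_ : FSet → FSet → Set
X ⊆ Y = ∀ {A} → X A → Y A

_∩_ : FSet → FSet → FSet
(X ∩ Y) A = X A × Y A

Subst : Set
Subst = ℕ → Frm

sub : Subst → Frm → Frm
sub σ (var n) = σ n
sub σ ⊥'      = ⊥'
sub σ (A ∧ B) = sub σ A ∧ sub σ B
sub σ (A ∨ B) = sub σ A ∨ sub σ B
sub σ (A ⇒ B) = sub σ A ⇒ sub σ B

PositiveSubst : Subst → Set
PositiveSubst σ = ∀ n → Positive (σ n)

data Int : Frm → Set where
  k    : ∀ A B → Int (A ⇒ B ⇒ A)
  s    : ∀ A B C → Int ((A ⇒ B ⇒ C) ⇒ (A ⇒ B) ⇒ A ⇒ C)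
  ∧e₁  : ∀ A B → Int (A ∧ B ⇒ A)
  ∧e₂  : ∀ A B → Int (A ∧ B ⇒ B)
  ∧i   : ∀ A B → Int (A ⇒ B ⇒ A ∧ B)
  ∨i₁  : ∀ A B → Int (A ⇒ A ∨ B)
  ∨i₂  : ∀ A B → Int (B ⇒ A ∨ B)
  ∨e   : ∀ A B C → Int ((A ⇒ C) ⇒ (B ⇒ C) ⇒ A ∨ B ⇒ C)
  efq  : ∀ A → Int (⊥' ⇒ A)
  mp   : ∀ {A B} → Int A → Int (A ⇒ B) → Int B

Int⁺ : FSet
Int⁺ = Int ∩ Positive

record SiLogic (L : FSet) : Set where
  field
    contains-Int : Int ⊆ L
    closed-mp    : ∀ {A B} → L A → L (A ⇒ B) → L B
    closed-sub   : ∀ (σ : Subst) {A} → L A → L (sub σ A)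

record PositiveLogic (P : FSet) : Set where
  field
    only-positive : P ⊆ Positive
    contains-Int⁺ : Int⁺ ⊆ P
    closed-mp     : ∀ {A B} → P A → P (A ⇒ B) → P B
    closed-possub : ∀ (σ : Subst) → PositiveSubst σ → ∀ {A} → P A → P (sub σ A)

-- Int + Γ : the least si-logic containing Int ∪ Γ, generated inductively
data IntPlus (Γ : FSet) : Frm → Set where
  int : ∀ {A} → Int A → IntPlus Γ A
  hyp : ∀ {A} → Γ A → IntPlus Γ A
  mp  : ∀ {A B} → IntPlus Γ A → IntPlus Γ (A ⇒ B) → IntPlus Γ B
  sb  : ∀ (σ : Subst) {A} → IntPlus Γ A → IntPlus Γ (sub σ A)

-- Multiple-conclusion rules Γ/Δ: finite sets given as lists
record Rule : Set where
  constructor _/_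
  field
    prem : List Frm
    concl : List Frm
open Rule public

PositiveRule : Rule → Set
PositiveRule r = All Positive (prem r) × All Positive (concl r)

Admissible : FSet → Rule → Set
Admissible L r =
  ∀ (σ : Subst) → All (λ A → L (sub σ A)) (prem r) → Any (λ B → L (sub σ B)) (concl r)

Admissible⁺ : FSet → Rule → Set
Admissible⁺ P r =
  ∀ (σ : Subst) → PositiveSubst σ →
    All (λ A → P (sub σ A)) (prem r) → Any (λ B → P (sub σ B)) (concl r)

-- The translation τ replaces ⊥ by a fresh variable q and every variable p by p ∨ q.
-- Since q ⇒ τ A is intuitionistically valid, τ turns ex falso into a positive theorem,
-- so P proves the τ-translation of every theorem of Int + P.  Substituting ⊥ for q
-- undoes τ inside Int + P, while for a positive A, substituting the conjunction of the
-- variables of A for q undoes τ inside P; the latter makes Int + P conservative over P.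
-- A unifier σ of the premises in Int + P thus yields the positive unifier τ ∘ σ in P,
-- and a positive unifier in P is one in Int + P.
module Submission where

open import Defs
open import Function.Bundles using (_⇔_; mk⇔)
open import Data.Nat using (zero; suc)
open import Data.List.Relation.Unary.All as All using (All; _∷_)
open import Data.List.Relation.Unary.Any using (Any; here; there)
open import Data.Product using (_×_; _,_; proj₁)
open import Relation.Binary.PropositionalEquality using (_≡_; refl; cong₂; subst; sym)

Any-mapWith : ∀ {P Q R : Frm → Set} → (∀ {x} → P x → Q x → R x) →
              ∀ {xs} → All P xs → Any Q xs → Any R xs
Any-mapWith f (p ∷ _)  (here q)  = here (f p q)
Any-mapWith f (_ ∷ ps) (there q) = there (Any-mapWith f ps q)

sub-positive : ∀ σ → PositiveSubst σ → ∀ {A} → Positive A → Positive (sub σ A)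
sub-positive σ σ⁺ (var n) = σ⁺ n
sub-positive σ σ⁺ (a ∧ b) = sub-positive σ σ⁺ a ∧ sub-positive σ σ⁺ b
sub-positive σ σ⁺ (a ∨ b) = sub-positive σ σ⁺ a ∨ sub-positive σ σ⁺ b
sub-positive σ σ⁺ (a ⇒ b) = sub-positive σ σ⁺ a ⇒ sub-positive σ σ⁺ b

⇒-refl : ∀ A → Int (A ⇒ A)
⇒-refl A = mp (k A A) (mp (k A (A ⇒ A)) (s A (A ⇒ A) A))

weaken : ∀ {A B} → Int B → Int (A ⇒ B)
weaken {A} {B} b = mp b (k B A)

⇒-mp : ∀ {A B C} → Int (A ⇒ B ⇒ C) → Int (A ⇒ B) → Int (A ⇒ C)
⇒-mp {A} {B} {C} f g = mp g (mp f (s A B C))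

⇒-trans : ∀ {A B C} → Int (A ⇒ B) → Int (B ⇒ C) → Int (A ⇒ C)
⇒-trans f g = ⇒-mp (weaken g) f

∧-mono : ∀ {A A' B B'} → Int (A ⇒ A') → Int (B ⇒ B') → Int (A ∧ B ⇒ A' ∧ B')
∧-mono {A} {A'} {B} {B'} f g =
  ⇒-mp (⇒-mp (weaken (∧i A' B')) (⇒-trans (∧e₁ A B) f)) (⇒-trans (∧e₂ A B) g)

∨-mono : ∀ {A A' B B'} → Int (A ⇒ A') → Int (B ⇒ B') → Int (A ∨ B ⇒ A' ∨ B')
∨-mono {A} {A'} {B} {B'} f g =
  mp (⇒-trans g (∨i₂ A' B')) (mp (⇒-trans f (∨i₁ A' B')) (∨e A B (A' ∨ B')))

⇒-monoʳ : ∀ {A B B'} → Int (B ⇒ B') → Int ((A ⇒ B) ⇒ (A ⇒ B'))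
⇒-monoʳ {A} {B} {B'} g = mp (weaken g) (s A B B')

⇒-antitoneˡ : ∀ {A A' B} → Int (A' ⇒ A) → Int ((A ⇒ B) ⇒ (A' ⇒ B))
⇒-antitoneˡ {A} {A'} {B} f = ⇒-mp (⇒-trans (k (A ⇒ B) A') (s A' A B)) (weaken f)

⇒-mono : ∀ {A A' B B'} → Int (A' ⇒ A) → Int (B ⇒ B') → Int ((A ⇒ B) ⇒ (A' ⇒ B'))
⇒-mono f g = ⇒-trans (⇒-antitoneˡ f) (⇒-monoʳ g)

infix 3 _⟺_
_⟺_ : Frm → Frm → Set
A ⟺ B = Int (A ⇒ B) × Int (B ⇒ A)

∧-cong : ∀ {A A' B B'} → A ⟺ A' → B ⟺ B' → A ∧ B ⟺ A' ∧ B'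
∧-cong (f , f') (g , g') = ∧-mono f g , ∧-mono f' g'

∨-cong : ∀ {A A' B B'} → A ⟺ A' → B ⟺ B' → A ∨ B ⟺ A' ∨ B'
∨-cong (f , f') (g , g') = ∨-mono f g , ∨-mono f' g'

⇒-cong : ∀ {A A' B B'} → A ⟺ A' → B ⟺ B' → (A ⇒ B) ⟺ (A' ⇒ B')
⇒-cong (f , f') (g , g') = ⇒-mono f' g , ⇒-mono f g'

∨-absorb : ∀ {A B} → Int (B ⇒ A) → A ∨ B ⟺ A
∨-absorb {A} {B} h = mp h (mp (⇒-refl A) (∨e A B A)) , ∨i₁ A B

q : Frm
q = var 0

-- Variable n of the source becomes variable suc n, keeping var 0 free for q.
τ : Frm → Frm
τ (var n) = var (suc n) ∨ q
τ ⊥'      = q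
τ (A ∧ B) = τ A ∧ τ B
τ (A ∨ B) = τ A ∨ τ B
τ (A ⇒ B) = τ A ⇒ τ B

τ-positive : ∀ A → Positive (τ A)
τ-positive (var n) = var (suc n) ∨ var 0
τ-positive ⊥'      = var 0
τ-positive (A ∧ B) = τ-positive A ∧ τ-positive B
τ-positive (A ∨ B) = τ-positive A ∨ τ-positive B
τ-positive (A ⇒ B) = τ-positive A ⇒ τ-positive B

q⇒τ : ∀ A → Int (q ⇒ τ A)
q⇒τ (var n) = ∨i₂ (var (suc n)) q
q⇒τ ⊥'      = ⇒-refl q
q⇒τ (A ∧ B) = ⇒-mp (⇒-mp (weaken (∧i (τ A) (τ B))) (q⇒τ A)) (q⇒τ B)
q⇒τ (A ∨ B) = ⇒-trans (q⇒τ A) (∨i₁ (τ A) (τ B))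
q⇒τ (A ⇒ B) = ⇒-trans (q⇒τ B) (k (τ B) (τ A))

τ-Int : ∀ {A} → Int A → Int (τ A)
τ-Int (k A B)     = k (τ A) (τ B)
τ-Int (s A B C)   = s (τ A) (τ B) (τ C)
τ-Int (∧e₁ A B)   = ∧e₁ (τ A) (τ B)
τ-Int (∧e₂ A B)   = ∧e₂ (τ A) (τ B)
τ-Int (∧i A B)    = ∧i (τ A) (τ B)
τ-Int (∨i₁ A B)   = ∨i₁ (τ A) (τ B)
τ-Int (∨i₂ A B)   = ∨i₂ (τ A) (τ B)
τ-Int (∨e A B C)  = ∨e (τ A) (τ B) (τ C)
τ-Int (efq A)     = q⇒τ A
τ-Int (mp a a⇒b)  = mp (τ-Int a) (τ-Int a⇒b)

τ-sub : ∀ σ {A} → Positive A → τ (sub σ A) ≡ sub (λ n → τ (σ n)) A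
τ-sub σ (var n) = refl
τ-sub σ (a ∧ b) = cong₂ _∧_ (τ-sub σ a) (τ-sub σ b)
τ-sub σ (a ∨ b) = cong₂ _∨_ (τ-sub σ a) (τ-sub σ b)
τ-sub σ (a ⇒ b) = cong₂ _⇒_ (τ-sub σ a) (τ-sub σ b)

τ-onPositive : ∀ {A} → Positive A → τ A ≡ sub (λ n → τ (var n)) A
τ-onPositive (var n) = refl
τ-onPositive (a ∧ b) = cong₂ _∧_ (τ-onPositive a) (τ-onPositive b)
τ-onPositive (a ∨ b) = cong₂ _∨_ (τ-onPositive a) (τ-onPositive b)
τ-onPositive (a ⇒ b) = cong₂ _⇒_ (τ-onPositive a) (τ-onPositive b)

τ-lift : Subst → Subst
τ-lift σ zero    = q
τ-lift σ (suc n) = τ (σ n)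

τ-lift-positive : ∀ σ → PositiveSubst (τ-lift σ)
τ-lift-positive σ zero    = var 0
τ-lift-positive σ (suc n) = τ-positive (σ n)

τ-lift-sub : ∀ σ A → sub (τ-lift σ) (τ A) ⟺ τ (sub σ A)
τ-lift-sub σ (var n) = ∨-absorb (q⇒τ (σ n))
τ-lift-sub σ ⊥'      = ⇒-refl q , ⇒-refl q
τ-lift-sub σ (A ∧ B) = ∧-cong (τ-lift-sub σ A) (τ-lift-sub σ B)
τ-lift-sub σ (A ∨ B) = ∨-cong (τ-lift-sub σ A) (τ-lift-sub σ B)
τ-lift-sub σ (A ⇒ B) = ⇒-cong (τ-lift-sub σ A) (τ-lift-sub σ B)

untag : Frm → Subst
untag Q zero    = Q
untag Q (suc n) = var n

-- The conjunction of the variables (and ⊥) of A: positive when A is, so it may replace q inside P.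
atoms : Frm → Frm
atoms (var n) = var n
atoms ⊥'      = ⊥'
atoms (A ∧ B) = atoms A ∧ atoms B
atoms (A ∨ B) = atoms A ∧ atoms B
atoms (A ⇒ B) = atoms A ∧ atoms B

atoms-positive : ∀ {A} → Positive A → Positive (atoms A)
atoms-positive (var n) = var n
atoms-positive (a ∧ b) = atoms-positive a ∧ atoms-positive b
atoms-positive (a ∨ b) = atoms-positive a ∧ atoms-positive b
atoms-positive (a ⇒ b) = atoms-positive a ∧ atoms-positive b

untag-positive : ∀ {A} → Positive A → PositiveSubst (untag A)
untag-positive a zero    = a
untag-positive a (suc n) = var n

untag-τ : ∀ Q A → Int (Q ⇒ atoms A) → sub (untag Q) (τ A) ⟺ A
untag-τ Q (var n) h = ∨-absorb h
untag-τ Q ⊥'      h = h , efq Q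
untag-τ Q (A ∧ B) h = ∧-cong (untag-τ Q A (⇒-trans h (∧e₁ _ _))) (untag-τ Q B (⇒-trans h (∧e₂ _ _)))
untag-τ Q (A ∨ B) h = ∨-cong (untag-τ Q A (⇒-trans h (∧e₁ _ _))) (untag-τ Q B (⇒-trans h (∧e₂ _ _)))
untag-τ Q (A ⇒ B) h = ⇒-cong (untag-τ Q A (⇒-trans h (∧e₁ _ _))) (untag-τ Q B (⇒-trans h (∧e₂ _ _)))

IntPlus-untag⊥ : ∀ {Γ A} → IntPlus Γ (τ A) → IntPlus Γ A
IntPlus-untag⊥ {A = A} d = mp (sb (untag ⊥') d) (int (proj₁ (untag-τ ⊥' A (efq _))))

module _ {P : FSet} (logic : PositiveLogic P) where
  open PositiveLogic logic

  Int⇒P : ∀ {A} → Int A → Positive A → P A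
  Int⇒P i a = contains-Int⁺ (i , a)

  P-mpInt : ∀ {A B} → P A → Int (A ⇒ B) → Positive B → P B
  P-mpInt pa i b = closed-mp pa (Int⇒P i (only-positive pa ⇒ b))

  τ-IntPlus : ∀ {A} → IntPlus P A → P (τ A)
  τ-IntPlus (int i)    = Int⇒P (τ-Int i) (τ-positive _)
  τ-IntPlus (hyp h)    =
    subst P (sym (τ-onPositive (only-positive h)))
      (closed-possub _ (λ n → τ-positive (var n)) h)
  τ-IntPlus (mp a a⇒b) = closed-mp (τ-IntPlus a) (τ-IntPlus a⇒b)
  τ-IntPlus (sb σ {A} d) =
    P-mpInt (closed-possub (τ-lift σ) (τ-lift-positive σ) (τ-IntPlus d))
        (proj₁ (τ-lift-sub σ A)) (τ-positive (sub σ A))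

  IntPlus-conservative : ∀ {A} → Positive A → IntPlus P A → P A
  IntPlus-conservative {A} a d =
    P-mpInt (closed-possub (untag (atoms A)) (untag-positive (atoms-positive a)) (τ-IntPlus d))
        (proj₁ (untag-τ (atoms A) A (⇒-refl _))) a

  admissible⁺⇒admissible : ∀ r → PositiveRule r → Admissible⁺ P r → Admissible (IntPlus P) r
  admissible⁺⇒admissible r (prem⁺ , concl⁺) adm σ unified =
    Any-mapWith (λ b h → IntPlus-untag⊥ (hyp (subst P (sym (τ-sub σ b)) h))) concl⁺
      (adm (λ n → τ (σ n)) (λ n → τ-positive (σ n))
        (All.zipWith (λ (a , h) → subst P (τ-sub σ a) (τ-IntPlus h)) (prem⁺ , unified)))

  admissible⇒admissible⁺ : ∀ r → PositiveRule r → Admissible (IntPlus P) r → Admissible⁺ P r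
  admissible⇒admissible⁺ r (_ , concl⁺) adm σ σ⁺ unified =
    Any-mapWith (λ b → IntPlus-conservative (sub-positive σ σ⁺ b)) concl⁺
      (adm σ (All.map hyp unified))

mainTheorem1 : (P : FSet) → PositiveLogic P → (r : Rule) → PositiveRule r →
    (Admissible⁺ P r ⇔ Admissible (IntPlus P) r)
mainTheorem1 P logic r r⁺ =
  mk⇔ (admissible⁺⇒admissible logic r r⁺) (admissible⇒admissible⁺ logic r r⁺)
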